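{- Let $x:[t]\to\mathbb{Z}\setminus\{0\}$ be such that $(x(1),\ldots,x(t))$ is generalized Catalan with $2y$ runs, and let $\pi$ be the permutation associated to $x$. Let $1\le j\le y$. If $h\in\Psi_j$ and $x(\pi(h+1))>0$, then $\sum_{k=1}^h x(\pi(k))\in[0,\beta_j)$ (for $h=0$ the sum is empty and equals $0$).
   Context: A list $(x_1,\ldots,x_t)$ of nonzero integers is generalized Catalan if $\sum_{i=1}^t x_i=0$ and $\sum_{i=1}^q x_i\ge0$ for all $1\le q\le t$. A run is a maximal block of consecutive entries of the same sign; a down-run consists of negative entries. A generalized Catalan list has $2y$ runs, alternately up- and down-runs, starting with an up-run. $D_j\subset[t]$ is the set of indices of the $j$-th down-run ($1\le j\le y$) and $\beta_j$ is the maximum absolute value of an entry of the $j$-th down-run. The permutation $\pi$ associated to $x$: $\pi(1)=1$; for $2\le q\le t$, let $s=\min\{i\in[t]: i\notin\{\pi(1),\ldots,\pi(q-1)\},\ x(i)<0\}$ and $s'=\min\{i\in[t]: i\notin\{\pi(1),\ldots,\pi(q-1)\},\ x(i)>0\}$ (minimum of the empty set is $\infty$); then $\pi(q)=s$ if $s<\infty$ and $\sum_{i=1}^{q-1}x(\pi(i))+x(s)\ge0$, and $\pi(q)=s'$ otherwise (this yields a permutation of $[t]$). Let $\delta_j=\max\{l:\pi(l)\in D_j\}$. The $j$-th down-phase is $\Psi_j=\{\delta_{j-1},\delta_{j-1}+1,\ldots,\delta_j-1\}$ for $j>1$ and $\Psi_1=\{0,1,\ldots,\delta_1-1\}$. 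-}

module Defs where

open import Data.Bool using (Bool; true; false; _∧_; _∨_; not; if_then_else_)
open import Data.Nat as ℕ using (ℕ; zero; suc; _⊔_)
open import Data.Integer as ℤ using (ℤ; 0ℤ; ∣_∣)
open import Data.List using (List; []; _∷_; length; map; take; upTo; foldr; filter; _++_; [_])
open import Data.Maybe using (Maybe; just; nothing)
open import Relation.Nullary.Decidable using (⌊_⌋)
open import Relation.Binary.PropositionalEquality using (_≡_)
open import Data.Empty using (⊥)
open import Data.Product using (_×_)
import Data.Bool as B

-- Conventions: a list x = (x(1),…,x(t)) is a `List ℤ`; positions of [t] are
-- encoded 0-based: position i ∈ [t] is the natural number i-1.

sumℤ : List ℤ → ℤ
sumℤ = foldr ℤ._+_ 0ℤ

-- value at 0-based position (0 outside the range; never used there)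
at : List ℤ → ℕ → ℤ
at []       _       = 0ℤ
at (a ∷ _)  zero    = a
at (_ ∷ as) (suc i) = at as i

atℕ : List ℕ → ℕ → ℕ
atℕ []       _       = 0
atℕ (a ∷ _)  zero    = a
atℕ (_ ∷ as) (suc i) = atℕ as i

isNeg isPos : ℤ → Bool
isNeg z = ⌊ z ℤ.<? 0ℤ ⌋
isPos z = ⌊ 0ℤ ℤ.<? z ⌋

record GeneralizedCatalan (xs : List ℤ) : Set where
  field
    nonzero   : ∀ i → i ℕ.< length xs → (at xs i ≡ 0ℤ → ⊥)
    sumZero   : sumℤ xs ≡ 0ℤ
    prefixNonneg : ∀ q → 1 ℕ.≤ q → q ℕ.≤ length xs → 0ℤ ℤ.≤ sumℤ (take q xs)

sameSign : ℤ → ℤ → Bool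
sameSign a b = (isNeg a ∧ isNeg b) ∨ (isPos a ∧ isPos b)

runStart : List ℤ → ℕ → Bool
runStart xs zero    = true
runStart xs (suc i) = not (sameSign (at xs i) (at xs (suc i)))

numRuns : List ℤ → ℕ
numRuns xs = length (filter (λ i → runStart xs i B.≟ true) (upTo (length xs)))

-- number of down-runs starting at a position ≤ i (i.e. the index of the
-- down-run containing i, when x(i) < 0)
downRunNo : List ℤ → ℕ → ℕ
downRunNo xs zero    = if isNeg (at xs 0) then 1 else 0
downRunNo xs (suc i) = (if isNeg (at xs (suc i)) ∧ runStart xs (suc i) then 1 else 0)
                       ℕ.+ downRunNo xs i

inD : List ℤ → ℕ → ℕ → Bool
inD xs j i = ⌊ i ℕ.<? length xs ⌋ ∧ isNeg (at xs i) ∧ ⌊ downRunNo xs i ℕ.≟ j ⌋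

β : List ℤ → ℕ → ℕ
β xs j = foldr (λ i m → if inD xs j i then ∣ at xs i ∣ ⊔ m else m) 0 (upTo (length xs))

memℕ : ℕ → List ℕ → Bool
memℕ i []       = false
memℕ i (k ∷ ks) = ⌊ i ℕ.≟ k ⌋ ∨ memℕ i ks

firstUnused : List ℤ → (ℤ → Bool) → List ℕ → Maybe ℕ
firstUnused xs p used = go (upTo (length xs))
  where
  go : List ℕ → Maybe ℕ
  go []       = nothing
  go (i ∷ is) = if p (at xs i) ∧ not (memℕ i used) then just i else go is

-- one step of the construction of π: given π(1..q-1) (as `used`) and their
-- partial sum S, choose π(q)
nextπ : List ℤ → List ℕ → ℤ → Maybe ℕ
nextπ xs used S with firstUnused xs isNeg used | firstUnused xs isPos used
... | just s  | s' = if ⌊ 0ℤ ℤ.≤? (S ℤ.+ at xs s) ⌋ then just s else s'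
... | nothing | s' = s'

buildπ : List ℤ → ℕ → List ℕ → ℤ → List ℕ
buildπ xs zero    used S = used
buildπ xs (suc n) used S with nextπ xs used S
... | nothing = used
... | just i  = buildπ xs n (used ++ [ i ]) (S ℤ.+ at xs i)

-- the permutation π associated to x, as the list (π(1),…,π(t)) of
-- 0-based positions; π(1) = 1 (position 0)
perm : List ℤ → List ℕ
perm []         = []
perm xs@(a ∷ _) = buildπ xs (ℕ.pred (length xs)) [ 0 ] a

-- π(l) for 1-based l, as a 0-based position
πat : List ℤ → ℕ → ℕ
πat xs l = atℕ (perm xs) (ℕ.pred l)

-- δ_j = max { l ∈ [t] : π(l) ∈ D_j }  (0 if there is no such l, so δ_0 = 0)
δ : List ℤ → ℕ → ℕ
δ xs j = foldr (λ l m → if inD xs j (πat xs l) then l ⊔ m else m) 0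
               (map suc (upTo (length xs)))

InΨ : List ℤ → ℕ → ℕ → Set
InΨ xs j h = (if ⌊ j ℕ.≟ 1 ⌋ then 0 else δ xs (ℕ.pred j)) ℕ.≤ h × h ℕ.< δ xs j

partialSum : List ℤ → ℕ → ℤ
partialSum xs h = sumℤ (map (at xs) (take h (perm xs)))

{-# OPTIONS --safe #-}
-- Every prefix sum of x∘π is ≥ 0, since a negative entry is only taken when the sum stays
-- nonnegative. Now let h ∈ Ψ_j with x(π(h+1)) > 0. Because h < δ_j, some position e of D_j is
-- still unused after h steps. For h = 0 the sum is 0 < |x(e)| ≤ β_j. Otherwise π(h+1) is positive
-- only because the first unused negative position s (which exists, s ≤ e) would make the sum
-- negative, so S_h < |x(s)|. It remains to see s ∈ D_j. Negative positions enter π in increasing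
-- order, so all positions of D_{j-1} before e have been used by time δ_{j-1} ≤ h; as s ≤ e is an
-- unused negative position, it cannot lie in an earlier down-run, hence s ∈ D_j and |x(s)| ≤ β_j.
module Submission where

open import Defs
open import Data.Bool using (Bool; true; false; _∧_; not; if_then_else_)
open import Data.Bool.Properties using (∨-zeroʳ)
open import Data.Empty using (⊥; ⊥-elim)
open import Data.Integer using (ℤ; +_; 0ℤ; -[1+_]; ∣_∣; _+_; +<+; +≤+) renaming (_≤_ to _≤ℤ_; _<_ to _<ℤ_; _<?_ to _<ℤ?_; _≤?_ to _≤ℤ?_)
import Data.Integer.Properties as ℤ
open import Data.List using (List; []; _∷_; length; map; take; upTo; applyUpTo; foldr; _++_; [_])
open import Data.List.Properties using (map-++; ++-assoc; ++-identityʳ; length-++)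
open import Data.List.Membership.Propositional using (_∈_)
open import Data.List.Membership.Propositional.Properties using (∈-map⁺; ∈-map⁻; ∈-upTo⁺)
open import Data.List.Relation.Unary.Any using (here; there)
open import Data.Maybe using (Maybe; just; nothing)
open import Data.Nat using (ℕ; zero; suc; _⊔_; _≤_; _<_; _*_; z≤n; s≤s; _≟_; _≤?_; _<?_)
import Data.Nat as ℕ
open import Data.Nat.Properties
open import Data.Product using (_×_; _,_; proj₁; proj₂; ∃-syntax)
open import Data.Sum using (_⊎_; inj₁; inj₂)
open import Relation.Binary.PropositionalEquality hiding ([_])
open import Relation.Nullary using (yes; no)

≡true∧≡false⇒⊥ : ∀ {b} → b ≡ true → b ≡ false → ⊥
≡true∧≡false⇒⊥ refl ()

isNeg⇒<0 : ∀ {z} → isNeg z ≡ true → z <ℤ 0ℤ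
isNeg⇒<0 {z} neg with z <ℤ? 0ℤ
... | yes z<0 = z<0
isNeg⇒<0 {z} () | no _

>0⇒¬isNeg : ∀ {z} → 0ℤ <ℤ z → isNeg z ≡ false
>0⇒¬isNeg {z} 0<z with z <ℤ? 0ℤ
... | yes z<0 = ⊥-elim (ℤ.<-asym 0<z z<0)
... | no _    = refl

isNeg⇒¬isPos : ∀ {z} → isNeg z ≡ true → isPos z ≡ false
isNeg⇒¬isPos {z} neg with 0ℤ <ℤ? z
... | yes 0<z = ⊥-elim (ℤ.<-asym 0<z (isNeg⇒<0 neg))
... | no _    = refl

isPos⇒>0 : ∀ {z} → isPos z ≡ true → 0ℤ <ℤ z
isPos⇒>0 {z} pos with 0ℤ <ℤ? z
... | yes 0<z = 0<z
isPos⇒>0 {z} () | no _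

+<0⇒<∣∣ : ∀ S {z} → z <ℤ 0ℤ → S + z <ℤ 0ℤ → S <ℤ + ∣ z ∣
+<0⇒<∣∣ S { + n} (+<+ ()) _
+<0⇒<∣∣ S { -[1+ n ]} _ S+z<0 = subst (_<ℤ + suc n) cancel (ℤ.+-monoˡ-< (+ suc n) S+z<0)
  where
  cancel : S + -[1+ n ] + + suc n ≡ S
  cancel = begin
    S + -[1+ n ] + + suc n   ≡⟨ ℤ.+-assoc S -[1+ n ] (+ suc n) ⟩
    S + (-[1+ n ] + + suc n) ≡⟨ cong (λ w → S + w) (ℤ.+-inverseˡ (+ suc n)) ⟩
    S + 0ℤ                   ≡⟨ ℤ.+-identityʳ S ⟩
    S                        ∎
    where open ≡-Reasoning

head-positive : ∀ {a as} → GeneralizedCatalan (a ∷ as) → 0ℤ <ℤ a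
head-positive {a} catalan = ℤ.≤∧≢⇒< 0≤a (λ 0≡a → nonzero 0 (s≤s z≤n) (sym 0≡a))
  where
  open GeneralizedCatalan catalan
  0≤a : 0ℤ ≤ℤ a
  0≤a = subst (0ℤ ≤ℤ_) (ℤ.+-identityʳ a) (prefixNonneg 1 (s≤s z≤n) (s≤s z≤n))

AllUsedBelow : List ℤ → (ℤ → Bool) → List ℕ → ℕ → Set
AllUsedBelow xs p used s = ∀ {m} → m < s → p (at xs m) ≡ true → memℕ m used ≡ true

eligible : List ℤ → (ℤ → Bool) → List ℕ → ℕ → Bool
eligible xs p used i = p (at xs i) ∧ not (memℕ i used)

eligible⁻ : ∀ xs p used i → eligible xs p used i ≡ true → p (at xs i) ≡ true × memℕ i used ≡ false
eligible⁻ xs p used i _ with p (at xs i) | memℕ i used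
... | true | false = refl , refl

ineligible⁻ : ∀ xs p used i → eligible xs p used i ≡ false → p (at xs i) ≡ true → memℕ i used ≡ true
ineligible⁻ xs p used i _ _ with p (at xs i) | memℕ i used
... | true | true = refl

-- The scanning function of `firstUnused` is local to its definition and cannot be named; this
-- meta is solved by unification with it.
mutual
  firstUnusedIn : List ℤ → (ℤ → Bool) → List ℕ → List ℕ → Maybe ℕ
  firstUnusedIn = _

  firstUnused-unfold : ∀ xs p used → firstUnused xs p used ≡ firstUnusedIn xs p used (upTo (length xs))
  firstUnused-unfold xs p used with upTo (length xs)
  ... | _ = refl

firstUnusedIn-just : ∀ xs p used (f : ℕ → ℕ) n {s} → firstUnusedIn xs p used (applyUpTo f n) ≡ just s →
  ∃[ k ] k < n × f k ≡ s × eligible xs p used (f k) ≡ true × (∀ {m} → m < k → eligible xs p used (f m) ≡ false)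
firstUnusedIn-just xs p used f (suc n) found with eligible xs p used (f 0) in ok
firstUnusedIn-just xs p used f (suc n) refl | true = 0 , s≤s z≤n , refl , ok , λ ()
... | false with firstUnusedIn-just xs p used (λ i → f (suc i)) n found
... | k , k<n , fk≡s , okₖ , before = suc k , s≤s k<n , fk≡s , okₖ , before′
  where
  before′ : ∀ {m} → m < suc k → eligible xs p used (f m) ≡ false
  before′ {zero}  _         = ok
  before′ {suc m} (s≤s m<k) = before m<k

firstUnusedIn-nothing : ∀ xs p used (f : ℕ → ℕ) n → firstUnusedIn xs p used (applyUpTo f n) ≡ nothing →
  ∀ {m} → m < n → eligible xs p used (f m) ≡ false
firstUnusedIn-nothing xs p used f (suc n) none {m} m<n with eligible xs p used (f 0) in ok
firstUnusedIn-nothing xs p used f (suc n) () {m} m<n | true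
firstUnusedIn-nothing xs p used f (suc n) none {zero}  _         | false = ok
firstUnusedIn-nothing xs p used f (suc n) none {suc m} (s≤s m<n) | false =
  firstUnusedIn-nothing xs p used (λ i → f (suc i)) n none m<n

firstUnused-just : ∀ {xs p used s} → firstUnused xs p used ≡ just s →
  s < length xs × p (at xs s) ≡ true × memℕ s used ≡ false × AllUsedBelow xs p used s
firstUnused-just {xs} {p} {used} found
  with firstUnusedIn-just xs p used (λ i → i) (length xs) (trans (sym (firstUnused-unfold xs p used)) found)
... | s , s<t , refl , ok , before =
  s<t , proj₁ (eligible⁻ xs p used s ok) , proj₂ (eligible⁻ xs p used s ok) ,
  λ m<s pm → ineligible⁻ xs p used _ (before m<s) pm

firstUnused-nothing : ∀ {xs p used} → firstUnused xs p used ≡ nothing → AllUsedBelow xs p used (length xs)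
firstUnused-nothing {xs} {p} {used} none m<t =
  ineligible⁻ xs p used _ (firstUnusedIn-nothing xs p used (λ i → i) (length xs)
    (trans (sym (firstUnused-unfold xs p used)) none) m<t)

data Choice (xs : List ℤ) (used : List ℕ) (S : ℤ) (c : ℕ) : Set where
  negative : isNeg (at xs c) ≡ true → 0ℤ ≤ℤ S + at xs c → AllUsedBelow xs isNeg used c → Choice xs used S c
  positive : isPos (at xs c) ≡ true →
             firstUnused xs isNeg used ≡ nothing ⊎ (∃[ s ] firstUnused xs isNeg used ≡ just s × S + at xs s <ℤ 0ℤ) →
             Choice xs used S c

nextπ-just : ∀ {xs used S c} → nextπ xs used S ≡ just c → c < length xs × memℕ c used ≡ false × Choice xs used S c
nextπ-just {xs} {used} {S} chosen
  with firstUnused xs isNeg used in neg? | firstUnused xs isPos used in pos?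
... | just s | s' with 0ℤ ≤ℤ? S + at xs s
nextπ-just {xs} {used} refl | just s | _ | yes 0≤S+xs with firstUnused-just {xs} {isNeg} {used} neg?
... | s<t , neg , fresh , before = s<t , fresh , negative neg 0≤S+xs before
nextπ-just {xs} {used} refl | just s | just s' | no S+xs≱0 with firstUnused-just {xs} {isPos} {used} pos?
... | s'<t , pos , fresh , _ = s'<t , fresh , positive pos (inj₂ (s , neg? , ℤ.≰⇒> S+xs≱0))
nextπ-just {xs} {used} refl | nothing | just s' with firstUnused-just {xs} {isPos} {used} pos?
... | s'<t , pos , fresh , _ = s'<t , fresh , positive pos (inj₁ neg?)

memℕ-take-atℕ : ∀ (L : List ℕ) {h m} → m < h → m < length L → memℕ (atℕ L m) (take h L) ≡ true
memℕ-take-atℕ (a ∷ L) {suc h} {zero}  _         _         rewrite ≟-diag (refl {x = a}) = refl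
memℕ-take-atℕ (a ∷ L) {suc h} {suc m} (s≤s m<h) (s≤s m<L) rewrite memℕ-take-atℕ L m<h m<L = ∨-zeroʳ _

memℕ-take⁻ : ∀ (L : List ℕ) {h i} → memℕ i (take h L) ≡ true → ∃[ m ] m < h × m < length L × atℕ L m ≡ i
memℕ-take⁻ (a ∷ L) {suc h} {i} found with i ≟ a
... | yes refl = 0 , s≤s z≤n , s≤s z≤n , refl
... | no _ with memℕ-take⁻ L found
... | m , m<h , m<L , Lm≡i = suc m , s≤s m<h , s≤s m<L , Lm≡i

atℕ-beyond : ∀ (L : List ℕ) {i} → length L ≤ i → atℕ L i ≡ 0
atℕ-beyond []      _         = refl
atℕ-beyond (a ∷ L) (s≤s L≤i) = atℕ-beyond L L≤i

atℕ-length-++ : ∀ (us : List ℕ) i r → atℕ (us ++ i ∷ r) (length us) ≡ i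
atℕ-length-++ []       i r = refl
atℕ-length-++ (u ∷ us) i r = atℕ-length-++ us i r

take-length-++ : ∀ (us r : List ℕ) → take (length us) (us ++ r) ≡ us
take-length-++ []       r = refl
take-length-++ (u ∷ us) r = cong (u ∷_) (take-length-++ us r)

take-suc-atℕ : ∀ (L : List ℕ) {h} → h < length L → take (suc h) L ≡ take h L ++ [ atℕ L h ]
take-suc-atℕ (a ∷ L) {zero}  _         = refl
take-suc-atℕ (a ∷ L) {suc h} (s≤s h<L) = cong (a ∷_) (take-suc-atℕ L h<L)

sumℤ-++ : ∀ (as bs : List ℤ) → sumℤ (as ++ bs) ≡ sumℤ as + sumℤ bs
sumℤ-++ []       bs = sym (ℤ.+-identityˡ _)
sumℤ-++ (a ∷ as) bs rewrite sumℤ-++ as bs = sym (ℤ.+-assoc a (sumℤ as) (sumℤ bs))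

sumℤ-map-snoc : ∀ xs (us : List ℕ) i → sumℤ (map (at xs) (us ++ [ i ])) ≡ sumℤ (map (at xs) us) + at xs i
sumℤ-map-snoc xs us i
  rewrite map-++ (at xs) us [ i ] | sumℤ-++ (map (at xs) us) [ at xs i ] | ℤ.+-identityʳ (at xs i) = refl

buildπ-extends : ∀ xs n used S → ∃[ rest ] buildπ xs n used S ≡ used ++ rest
buildπ-extends xs zero    used S = [] , sym (++-identityʳ used)
buildπ-extends xs (suc n) used S with nextπ xs used S
... | nothing = [] , sym (++-identityʳ used)
... | just i with buildπ-extends xs n (used ++ [ i ]) (S + at xs i)
... | rest , extended = i ∷ rest , trans extended (++-assoc used [ i ] rest)

length-buildπ : ∀ xs n used S → length (buildπ xs n used S) ≤ length used ℕ.+ n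
length-buildπ xs zero    used S = m≤m+n (length used) 0
length-buildπ xs (suc n) used S with nextπ xs used S
... | nothing = m≤m+n (length used) (suc n)
... | just i  = begin
  length (buildπ xs n (used ++ [ i ]) (S + at xs i)) ≤⟨ length-buildπ xs n (used ++ [ i ]) (S + at xs i) ⟩
  length (used ++ [ i ]) ℕ.+ n                      ≡⟨ cong (ℕ._+ n) (length-++ used) ⟩
  length used ℕ.+ 1 ℕ.+ n                           ≡⟨ +-assoc (length used) 1 n ⟩
  length used ℕ.+ suc n                             ∎
  where open ≤-Reasoning

buildπ-step : ∀ xs n used S → S ≡ sumℤ (map (at xs) used) →
  let L = buildπ xs n used S in
  ∀ {h} → length used ≤ h → h < length L → nextπ xs (take h L) (sumℤ (map (at xs) (take h L))) ≡ just (atℕ L h)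
buildπ-step xs zero    used S _ used≤h h<L = ⊥-elim (<⇒≱ h<L used≤h)
buildπ-step xs (suc n) used S S≡ used≤h h<L with nextπ xs used S in chosen
... | nothing = ⊥-elim (<⇒≱ h<L used≤h)
... | just i with m≤n⇒m<n∨m≡n used≤h
...   | inj₁ used<h =
  buildπ-step xs n (used ++ [ i ]) (S + at xs i)
    (trans (cong (_+ at xs i) S≡) (sym (sumℤ-map-snoc xs used i)))
    (subst (_≤ _) (sym (trans (length-++ used) (+-comm (length used) 1))) used<h) h<L
...   | inj₂ refl with buildπ-extends xs n (used ++ [ i ]) (S + at xs i)
...     | rest , extended
  rewrite extended | ++-assoc used [ i ] rest | take-length-++ used (i ∷ rest) | atℕ-length-++ used i rest | sym S≡
  = chosen

downRunNo-suc : ∀ xs i → downRunNo xs (suc i) ≡ downRunNo xs i ⊎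
  (downRunNo xs (suc i) ≡ suc (downRunNo xs i) × isNeg (at xs (suc i)) ≡ true)
downRunNo-suc xs i with isNeg (at xs (suc i)) | runStart xs (suc i)
... | true  | true  = inj₂ (refl , refl)
... | true  | false = inj₁ refl
... | false | _     = inj₁ refl

downRunNo-mono : ∀ xs {i k} → i ≤ k → downRunNo xs i ≤ downRunNo xs k
downRunNo-mono xs {i} {k} i≤k with m≤n⇒m<n∨m≡n i≤k
... | inj₂ refl = ≤-refl
downRunNo-mono xs {i} {suc k} _ | inj₁ (s≤s i≤k) = ≤-trans (downRunNo-mono xs i≤k) (m≤n+m (downRunNo xs k) _)

negativeRun-continues : ∀ xs {i} → runStart xs (suc i) ≡ false → isNeg (at xs (suc i)) ≡ true → isNeg (at xs i) ≡ true
negativeRun-continues xs {i} continues neg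
  rewrite neg | isNeg⇒¬isPos neg with isNeg (at xs i) | isPos (at xs i)
... | true  | _ = refl
negativeRun-continues xs () neg | false | true
negativeRun-continues xs () neg | false | false

downRunNo-neg : ∀ xs {i} → isNeg (at xs i) ≡ true → 1 ≤ downRunNo xs i
downRunNo-neg xs {zero}  neg rewrite neg = s≤s z≤n
downRunNo-neg xs {suc i} neg with runStart xs (suc i) in start
... | true rewrite neg = s≤s z≤n
... | false = ≤-trans (downRunNo-neg xs (negativeRun-continues xs start neg)) (m≤n+m (downRunNo xs i) _)

downRunNo-intermediate : ∀ xs {s e k} → s ≤ e → isNeg (at xs s) ≡ true → downRunNo xs s ≤ k → k ≤ downRunNo xs e →
  ∃[ d ] s ≤ d × d ≤ e × isNeg (at xs d) ≡ true × downRunNo xs d ≡ k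
downRunNo-intermediate xs {s} {e} s≤e neg lower upper with m≤n⇒m<n∨m≡n s≤e
... | inj₂ refl = s , ≤-refl , ≤-refl , neg , ≤-antisym lower upper
downRunNo-intermediate xs {s} {suc e} {k} _ neg lower upper | inj₁ (s≤s s≤e) with k ≤? downRunNo xs e
... | yes k≤ with downRunNo-intermediate xs s≤e neg lower k≤
...   | d , s≤d , d≤e , negd , dk = d , s≤d , m≤n⇒m≤1+n d≤e , negd , dk
downRunNo-intermediate xs {s} {suc e} {k} _ neg lower upper | inj₁ (s≤s s≤e) | no k≰ with downRunNo-suc xs e
... | inj₁ same = ⊥-elim (k≰ (subst (k ≤_) same upper))
... | inj₂ (step , nege) = suc e , m≤n⇒m≤1+n s≤e , ≤-refl , nege , ≤-antisym (subst (_≤ k) (sym step) (≰⇒> k≰)) upper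

-- β and δ unfold definitionally to instances of maxOver.
maxOver : (ℕ → Bool) → (ℕ → ℕ) → List ℕ → ℕ
maxOver c f = foldr (λ l m → if c l then f l ⊔ m else m) 0

maxOver-upper : ∀ c f {ls l} → l ∈ ls → c l ≡ true → f l ≤ maxOver c f ls
maxOver-upper c f {l ∷ ls} (here refl) cl rewrite cl = m≤m⊔n (f l) _
maxOver-upper c f {l′ ∷ ls} (there l∈) cl with c l′
... | true  = ≤-trans (maxOver-upper c f l∈ cl) (m≤n⊔m (f l′) _)
... | false = maxOver-upper c f l∈ cl

maxOver-attained : ∀ c f {ls} → 0 < maxOver c f ls → ∃[ l ] l ∈ ls × c l ≡ true × maxOver c f ls ≤ f l
maxOver-attained c f {l ∷ ls} 0<max with c l in cl
... | false with maxOver-attained c f 0<max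
...   | l′ , l′∈ , cl′ , max≤ = l′ , there l′∈ , cl′ , max≤
maxOver-attained c f {l ∷ ls} 0<max | true with ⊔-sel (f l) (maxOver c f ls)
... | inj₁ isL = l , here refl , cl , ≤-reflexive isL
... | inj₂ isR with maxOver-attained c f (subst (0 <_) isR 0<max)
...   | l′ , l′∈ , cl′ , max≤ = l′ , there l′∈ , cl′ , ≤-trans (≤-reflexive isR) max≤

inD⁻ : ∀ xs j i → inD xs j i ≡ true → i < length xs × isNeg (at xs i) ≡ true × downRunNo xs i ≡ j
inD⁻ xs j i _ with i <? length xs | isNeg (at xs i) | downRunNo xs i ≟ j
... | yes i<t | true | yes dj = i<t , refl , dj

inD⁺ : ∀ xs {j i} → i < length xs → isNeg (at xs i) ≡ true → downRunNo xs i ≡ j → inD xs j i ≡ true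
inD⁺ xs {j} {i} i<t neg dj with i <? length xs | downRunNo xs i ≟ j
... | yes _ | yes _ rewrite neg = refl
... | no i≮t | _     = ⊥-elim (i≮t i<t)
... | yes _ | no d≢j = ⊥-elim (d≢j dj)

β-upper : ∀ xs {j i} → inD xs j i ≡ true → ∣ at xs i ∣ ≤ β xs j
β-upper xs {j} {i} i∈D = maxOver-upper (inD xs j) (λ i → ∣ at xs i ∣) (∈-upTo⁺ (proj₁ (inD⁻ xs j i i∈D))) i∈D

+<0⇒<β : ∀ xs {j} S s → inD xs j s ≡ true → S + at xs s <ℤ 0ℤ → S <ℤ + β xs j
+<0⇒<β xs {j} S s s∈D S+x<0 =
  ℤ.<-≤-trans (+<0⇒<∣∣ S (isNeg⇒<0 (proj₁ (proj₂ (inD⁻ xs j s s∈D)))) S+x<0) (+≤+ (β-upper xs s∈D))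

δ-upper : ∀ xs {k m} → m < length xs → inD xs k (atℕ (perm xs) m) ≡ true → suc m ≤ δ xs k
δ-upper xs {k} m<t πm∈D = maxOver-upper (λ l → inD xs k (πat xs l)) (λ l → l) (∈-map⁺ suc (∈-upTo⁺ m<t)) πm∈D

δ-attained : ∀ xs {k h} → h < δ xs k → ∃[ i ] h ≤ i × inD xs k (atℕ (perm xs) i) ≡ true
δ-attained xs {k} h<δ
  with maxOver-attained (λ l → inD xs k (πat xs l)) (λ l → l) {map suc (upTo (length xs))} (≤-<-trans z≤n h<δ)
... | l , l∈ , πl∈D , δ≤l with ∈-map⁻ suc l∈
...   | i , _ , refl = i , ≤-pred (<-≤-trans h<δ δ≤l) , πl∈D

data PhaseStart (xs : List ℤ) (h : ℕ) : ℕ → Set where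
  first : PhaseStart xs h 1
  after : ∀ {k} → δ xs k ≤ h → PhaseStart xs h (suc k)

InΨ⇒PhaseStart : ∀ xs {j h} → 1 ≤ j → InΨ xs j h → PhaseStart xs h j
InΨ⇒PhaseStart xs {suc zero}    _ _         = first
InΨ⇒PhaseStart xs {suc (suc k)} _ (δ≤h , _) = after δ≤h

module AssociatedPermutation (a : ℤ) (as : List ℤ) where

  xs : List ℤ
  xs = a ∷ as

  L : List ℕ
  L = perm xs

  perm-head : atℕ L 0 ≡ 0
  perm-head with buildπ-extends xs (length as) [ 0 ] a
  ... | rest , extended rewrite extended = refl

  length-perm : length L ≤ length xs
  length-perm = length-buildπ xs (length as) [ 0 ] a

  perm-choice : ∀ {h} → 1 ≤ h → h < length L →
    memℕ (atℕ L h) (take h L) ≡ false × Choice xs (take h L) (partialSum xs h) (atℕ L h)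
  perm-choice 1≤h h<L = proj₂ (nextπ-just (buildπ-step xs (length as) [ 0 ] a (sym (ℤ.+-identityʳ a)) 1≤h h<L))

  perm-injective : ∀ {k l} → k < l → l < length L → atℕ L k ≢ atℕ L l
  perm-injective {k} {suc l} k<l l<L Lk≡Ll =
    ≡true∧≡false⇒⊥ (subst (λ i → memℕ i (take (suc l) L) ≡ true) Lk≡Ll (memℕ-take-atℕ L k<l (<-trans k<l l<L)))
                   (proj₁ (perm-choice (s≤s z≤n) l<L))

  perm-fresh : ∀ {h i} → h ≤ i → i < length L → memℕ (atℕ L i) (take h L) ≡ false
  perm-fresh {h} {i} h≤i i<L with memℕ (atℕ L i) (take h L) in found
  ... | false = refl
  ... | true with memℕ-take⁻ L found
  ...   | m , m<h , _ , Lm≡Li = ⊥-elim (perm-injective (<-≤-trans m<h h≤i) i<L Lm≡Li)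

  partialSum-suc : ∀ {h} → h < length L → partialSum xs (suc h) ≡ partialSum xs h + at xs (atℕ L h)
  partialSum-suc {h} h<L rewrite take-suc-atℕ L h<L = sumℤ-map-snoc xs (take h L) (atℕ L h)

  module _ (a>0 : 0ℤ <ℤ a) where

    perm-negatives-ordered : ∀ {l} → l < length L → isNeg (at xs (atℕ L l)) ≡ true →
      AllUsedBelow xs isNeg (take l L) (atℕ L l)
    perm-negatives-ordered {zero} _ neg rewrite perm-head = ⊥-elim (≡true∧≡false⇒⊥ neg (>0⇒¬isNeg a>0))
    perm-negatives-ordered {suc l} l<L neg with proj₂ (perm-choice (s≤s z≤n) l<L)
    ... | negative _ _ before = before
    ... | positive pos _      = ⊥-elim (≡true∧≡false⇒⊥ pos (isNeg⇒¬isPos neg))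

    partialSum-step : ∀ {h} → 1 ≤ h → h < length L → 0ℤ ≤ℤ partialSum xs h → 0ℤ ≤ℤ partialSum xs (suc h)
    partialSum-step 1≤h h<L 0≤S rewrite partialSum-suc h<L with proj₂ (perm-choice 1≤h h<L)
    ... | negative _ 0≤S+x _ = 0≤S+x
    ... | positive pos _     = ℤ.+-mono-≤ 0≤S (ℤ.<⇒≤ (isPos⇒>0 pos))

    partialSum-nonneg : ∀ {h} → h ≤ length L → 0ℤ ≤ℤ partialSum xs h
    partialSum-nonneg {zero}        _   = +≤+ z≤n
    partialSum-nonneg {suc zero}    h<L rewrite partialSum-suc h<L | perm-head =
      subst (0ℤ ≤ℤ_) (sym (ℤ.+-identityˡ a)) (ℤ.<⇒≤ a>0)
    partialSum-nonneg {suc (suc h)} h<L = partialSum-step (s≤s z≤n) h<L (partialSum-nonneg (<⇒≤ h<L))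

    -- `atℕ` returns 0 beyond the end of π, and position 0 holds the positive head.
    perm-defined : ∀ {i} → isNeg (at xs (atℕ L i)) ≡ true → i < length L
    perm-defined {i} neg with i <? length L
    ... | yes i<L = i<L
    ... | no i≮L rewrite atℕ-beyond L (≮⇒≥ i≮L) = ⊥-elim (≡true∧≡false⇒⊥ neg (>0⇒¬isNeg a>0))

    used-negatives-downward : ∀ {h d} → memℕ d (take h L) ≡ true → isNeg (at xs d) ≡ true →
      AllUsedBelow xs isNeg (take h L) d
    used-negatives-downward {h} {d} d∈ negd {s} s<d negs with memℕ-take⁻ L {h} {d} d∈
    ... | m , m<h , m<L , refl with memℕ-take⁻ L {m} {s} (perm-negatives-ordered m<L negd s<d negs)
    ...   | m′ , m′<m , m′<L , refl = memℕ-take-atℕ L (<-trans m′<m m<h) m′<L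

    downRun-used : ∀ {k h i d} → isNeg (at xs (atℕ L i)) ≡ true → d < atℕ L i →
      inD xs k d ≡ true → δ xs k ≤ h → memℕ d (take h L) ≡ true
    downRun-used {k} {h} {i} {d} nege d<e d∈D δ≤h
      with memℕ-take⁻ L {i} {d} (perm-negatives-ordered (perm-defined nege) nege d<e (proj₁ (proj₂ (inD⁻ xs k d d∈D))))
    ... | m , _ , m<L , refl = memℕ-take-atℕ L (≤-trans (δ-upper xs (<-≤-trans m<L length-perm) d∈D) δ≤h) m<L

    earlierRun-used : ∀ {k h i s} → δ xs k ≤ h → inD xs (suc k) (atℕ L i) ≡ true →
      isNeg (at xs s) ≡ true → s ≤ atℕ L i → downRunNo xs s ≤ k →
      ∃[ d ] s ≤ d × isNeg (at xs d) ≡ true × memℕ d (take h L) ≡ true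
    earlierRun-used {k} {h} {i} {s} δ≤h e∈D negs s≤e ds≤k with inD⁻ xs (suc k) (atℕ L i) e∈D
    ... | e<t , nege , de with downRunNo-intermediate xs s≤e negs ds≤k (subst (k ≤_) (sym de) (n≤1+n k))
    ...   | d , s≤d , d≤e , negd , dk = d , s≤d , negd , downRun-used nege d<e (inD⁺ xs (<-trans d<e e<t) negd dk) δ≤h
      where
      d<e : d < atℕ L i
      d<e = ≤∧≢⇒< d≤e (λ d≡e → 1+n≢n (trans (sym de) (trans (cong (downRunNo xs) (sym d≡e)) dk)))

    unused-not-earlierRun : ∀ {j h i s} → PhaseStart xs h j → inD xs j (atℕ L i) ≡ true →
      isNeg (at xs s) ≡ true → memℕ s (take h L) ≡ false → s ≤ atℕ L i → downRunNo xs s < j → ⊥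
    unused-not-earlierRun {s = s} first _ negs _ _ ds<1 = <⇒≱ ds<1 (downRunNo-neg xs {s} negs)
    unused-not-earlierRun {h = h} {s = s} (after δ≤h) e∈D negs fresh s≤e (s≤s ds≤k)
      with earlierRun-used {h = h} {s = s} δ≤h e∈D negs s≤e ds≤k
    ... | d , s≤d , negd , used with m≤n⇒m<n∨m≡n s≤d
    ...   | inj₁ s<d  = ≡true∧≡false⇒⊥ (used-negatives-downward {h} used negd s<d negs) fresh
    ...   | inj₂ refl = ≡true∧≡false⇒⊥ used fresh

    unused-inD : ∀ {j h i s} → PhaseStart xs h j → inD xs j (atℕ L i) ≡ true → s < length xs →
      isNeg (at xs s) ≡ true → memℕ s (take h L) ≡ false → s ≤ atℕ L i → inD xs j s ≡ true
    unused-inD {j} {h} {i} {s} start e∈D s<t negs fresh s≤e =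
      inD⁺ xs s<t negs (≤-antisym (subst (downRunNo xs s ≤_) de (downRunNo-mono xs s≤e))
                                  (≮⇒≥ (unused-not-earlierRun start e∈D negs fresh s≤e)))
      where
      de : downRunNo xs (atℕ L i) ≡ j
      de = proj₂ (proj₂ (inD⁻ xs j (atℕ L i) e∈D))

    partialSum<β : ∀ {j h i} → PhaseStart xs h j → h ≤ i → inD xs j (atℕ L i) ≡ true →
      0ℤ <ℤ at xs (atℕ L h) → partialSum xs h <ℤ + β xs j
    partialSum<β {j} {zero} {i} _ _ e∈D _ =
      +<0⇒<β xs 0ℤ (atℕ L i) e∈D (subst (_<ℤ 0ℤ) (sym (ℤ.+-identityˡ _)) (isNeg⇒<0 (proj₁ (proj₂ (inD⁻ xs j (atℕ L i) e∈D)))))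
    partialSum<β {j} {h@(suc _)} {i} start h≤i e∈D πh>0 with inD⁻ xs j (atℕ L i) e∈D
    ... | e<t , nege , _ with perm-fresh h≤i (perm-defined nege) | perm-choice (s≤s z≤n) (≤-<-trans h≤i (perm-defined nege))
    ...   | _       | _ , negative negπ _ _ = ⊥-elim (≡true∧≡false⇒⊥ negπ (>0⇒¬isNeg πh>0))
    ...   | fresh-e | _ , positive _ (inj₁ none) =
      ⊥-elim (≡true∧≡false⇒⊥ (firstUnused-nothing {xs} {isNeg} {take h L} none e<t nege) fresh-e)
    ...   | fresh-e | _ , positive _ (inj₂ (s , found , S+x<0)) with firstUnused-just {xs} {isNeg} {take h L} found
    ...     | s<t , negs , fresh , before = +<0⇒<β xs _ s (unused-inD start e∈D s<t negs fresh s≤e) S+x<0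
      where
      s≤e : s ≤ atℕ L i
      s≤e = ≮⇒≥ (λ e<s → ≡true∧≡false⇒⊥ (before e<s nege) fresh-e)

proposition2p8 : (xs : List ℤ) (y : ℕ) → GeneralizedCatalan xs → numRuns xs ≡ 2 * y →
    (j : ℕ) → 1 ≤ j → j ≤ y → (h : ℕ) → InΨ xs j h →
    0ℤ <ℤ at xs (πat xs (Data.Nat.suc h)) →
    (0ℤ ≤ℤ partialSum xs h) × (partialSum xs h <ℤ + β xs j)
proposition2p8 []       _ _       _ _ _   _ _ (_ , ()) _
proposition2p8 (a ∷ as) _ catalan _ j 1≤j _ h h∈Ψ πh>0 with δ-attained (a ∷ as) (proj₂ h∈Ψ)
... | i , h≤i , e∈D =
  partialSum-nonneg a>0 (<⇒≤ (≤-<-trans h≤i (perm-defined a>0 nege))) ,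
  partialSum<β a>0 (InΨ⇒PhaseStart (a ∷ as) 1≤j h∈Ψ) h≤i e∈D πh>0
  where
  open AssociatedPermutation a as
  a>0 : 0ℤ <ℤ a
  a>0 = head-positive catalan
  nege : isNeg (at xs (atℕ L i)) ≡ true
  nege = proj₁ (proj₂ (inD⁻ xs j (atℕ L i) e∈D))
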